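{- Let $K_n$ be the complete graph on $n\ge 2$ vertices, let $v\in V(K_n)$, and let $B:=L_{K_n}(v)$ be the principal submatrix of the Laplacian $L_{K_n}$ obtained by deleting the row and column indexed by $v$. Then \[ \operatorname{per}(B\circ B)\ \le\ \operatorname{per}(B)^2. \]
   Context: The Laplacian of a simple graph is $L=D-A$ (degree matrix minus adjacency matrix). $\operatorname{per}$ denotes the permanent and $\circ$ the Hadamard (entrywise) product. -}

module Defs where

open import Data.Nat using (ℕ; zero; suc)
open import Data.Integer using (ℤ; +_; _-_; _*_; _+_)
open import Data.Fin using (Fin; zero; suc; punchIn)
open import Data.Fin.Properties using (_≟_)
open import Data.List using (List; []; _∷_; map; concatMap; allFin; filterᵇ)
open import Data.Bool using (Bool; true; false; if_then_else_; _∨_; not)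
open import Relation.Nullary.Decidable using (⌊_⌋)
open import Relation.Binary.PropositionalEquality using (_≡_; refl; sym)
open import Relation.Nullary using (yes; no)
open import Data.Empty using (⊥-elim)

Matrix : ℕ → Set
Matrix m = Fin m → Fin m → ℤ

sumFin : ∀ {m} → (Fin m → ℤ) → ℤ
sumFin {zero} f = + 0
sumFin {suc m} f = f zero + sumFin (λ i → f (suc i))

prodFin : ∀ {m} → (Fin m → ℤ) → ℤ
prodFin {zero} f = + 1
prodFin {suc m} f = f zero * prodFin (λ i → f (suc i))

sumList : List ℤ → ℤ
sumList [] = + 0
sumList (x ∷ xs) = x + sumList xs

allFuns : ∀ k m → List (Fin k → Fin m)
allFuns zero m = (λ ()) ∷ []
allFuns (suc k) m =
  concatMap (λ j → map (λ g → λ { zero → j ; (suc i) → g i }) (allFuns k m)) (allFin m)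

allᵇ : ∀ {A : Set} → (A → Bool) → List A → Bool
allᵇ p [] = true
allᵇ p (x ∷ xs) = if p x then allᵇ p xs else false

-- Boolean injectivity test for σ : Fin m → Fin m (injective = bijective on Fin m).
isInjective : ∀ {m} → (Fin m → Fin m) → Bool
isInjective {m} σ =
  allᵇ (λ i → allᵇ (λ j → ⌊ i ≟ j ⌋ ∨ not ⌊ σ i ≟ σ j ⌋) (allFin m)) (allFin m)

permutations : ∀ m → List (Fin m → Fin m)
permutations m = filterᵇ isInjective (allFuns m m)

per : ∀ {m} → Matrix m → ℤ
per {m} A = sumList (map (λ σ → prodFin (λ i → A i (σ i))) (permutations m))

_∘ₕ_ : ∀ {m} → Matrix m → Matrix m → Matrix m
(A ∘ₕ B) i j = A i j * B i j

record SimpleGraph (n : ℕ) : Set where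
  field
    Adj : Fin n → Fin n → Bool
    symm : ∀ i j → Adj i j ≡ Adj j i
    irrefl : ∀ i → Adj i i ≡ false

open SimpleGraph public

adjacency : ∀ {n} → SimpleGraph n → Matrix n
adjacency G i j = if Adj G i j then + 1 else + 0

degree : ∀ {n} → SimpleGraph n → Fin n → ℤ
degree G i = sumFin (λ j → adjacency G i j)

laplacian : ∀ {n} → SimpleGraph n → Matrix n
laplacian G i j = (if ⌊ i ≟ j ⌋ then degree G i else + 0) - adjacency G i j

deleteRowCol : ∀ {n} → Fin (suc n) → Matrix (suc n) → Matrix n
deleteRowCol v M i j = M (punchIn v i) (punchIn v j)

completeGraph : ∀ n → SimpleGraph n
completeGraph n = record
  { Adj = λ i j → not ⌊ i ≟ j ⌋
  ; symm = symmK
  ; irrefl = irreflK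
  }
  where
  symmK : ∀ (i j : Fin n) → not ⌊ i ≟ j ⌋ ≡ not ⌊ j ≟ i ⌋
  symmK i j with i ≟ j | j ≟ i
  ... | yes _ | yes _ = refl
  ... | no _ | no _ = refl
  ... | yes p | no q = ⊥-elim (q (sym p))
  ... | no p | yes q = ⊥-elim (p (sym q))
  irreflK : ∀ (i : Fin n) → not ⌊ i ≟ i ⌋ ≡ false
  irreflK i with i ≟ i
  ... | yes _ = refl
  ... | no p = ⊥-elim (p refl)

module Submission where

-- Deleting a vertex from the Laplacian of K (n + 2) leaves B = x I − J with x = n + 2, of size
-- m = n + 1, and then B ∘ B = y I + J with y = n (n + 2).  For any matrix c I + o J of size k,
-- Laplace expansion along the rows carrying a diagonal c, one at a time, gives per = H k with
--   H 0 = 1,   H (k + 1) = c ^ (k + 1) + (k + 1) o H k.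
-- For o = −1 this recursion alternates and forces per B ≥ x ^ m / 2; for o = 1 it gives
-- (y − m) per (B ∘ B) ≤ y ^ (m + 1).  What is left, 4 y ^ (m + 1) ≤ (y − m) x ^ (2 m), follows for
-- n ≥ 2 from the first three terms of the binomial expansion of (n + 2) ^ n; n ≤ 1 is computed.

open import Defs
open import Data.Bool using (Bool; true; false; T; if_then_else_; _∧_; _∨_; not)
open import Data.Bool.Properties using (T-≡)
open import Data.Empty using (⊥-elim)
open import Data.Fin using (Fin; zero; suc; punchIn; punchOut; toℕ; fromℕ<)
open import Data.Fin.Properties
  using (_≟_; all?; punchIn-injective; punchInᵢ≢i; punchIn-punchOut; toℕ-fromℕ<; toℕ<n)
open import Data.Integer
  using (ℤ; +_; -[1+_]; _+_; _*_; _-_; _^_; _≤_; _<_; +≤+; +<+; positive)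
open import Data.Integer.Properties
  using (+-identityˡ; +-identityʳ; +-assoc; *-zeroˡ; *-zeroʳ; *-identityʳ; *-distribʳ-+; +-mono-≤;
         pos-*; i≤j⇒0≤j-i; 0≤i-j⇒j≤i; *-cancelˡ-≤-pos; ≤-trans; ≤-reflexive; <⇒≤; <-≤-trans;
         +-*-semiring)
open import Algebra.Properties.Semiring.Sum +-*-semiring
  using (sum; sum-cong-≗; ∑-comm; ∑-distrib-+; sum-remove; sum-replicate-zero; *-distribˡ-sum)
open import Data.Integer.Tactic.RingSolver using (solve-∀)
open import Data.List using (List; []; _∷_; _++_; map; concatMap; tabulate; allFin; filterᵇ)
open import Data.List.Properties using (map-++; map-∘; map-cong; map-tabulate)
open import Data.Nat as ℕ using (ℕ; zero; suc; z≤n; s≤s; _<ᵇ_)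
import Data.Nat.Properties as ℕ
open import Data.Product using (_×_; _,_; proj₁; proj₂)
open import Data.Vec.Functional using (Vector; head; tail) renaming (_∷_ to _∷ᶠ_)
open import Function using (_∘_; id; _⇔_; mk⇔; Equivalence)
open import Function.Definitions using (Injective)
open import Relation.Binary.Core using (_Preserves_⟶_)
open import Relation.Binary.PropositionalEquality
open import Relation.Nullary using (Dec; does; yes; no; ¬?; _×-dec_; _→-dec_; map′)
open import Relation.Nullary.Decidable using (⌊_⌋; does-⇔; T?; dec-true; dec-false; isYes≗does)

private
  variable
    k m : ℕ
    S : Set

sumList-++ : ∀ xs ys → sumList (xs ++ ys) ≡ sumList xs + sumList ys
sumList-++ []       ys = sym (+-identityˡ _)
sumList-++ (x ∷ xs) ys = trans (cong (_+_ x) (sumList-++ xs ys)) (sym (+-assoc x _ _))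

sumList-concatMap : ∀ {B : Set} (f : B → ℤ) (g : S → List B) xs →
  sumList (map f (concatMap g xs)) ≡ sumList (map (λ x → sumList (map f (g x))) xs)
sumList-concatMap f g []       = refl
sumList-concatMap f g (x ∷ xs) = begin
  sumList (map f (g x ++ concatMap g xs))                   ≡⟨ cong sumList (map-++ f (g x) _) ⟩
  sumList (map f (g x) ++ map f (concatMap g xs))           ≡⟨ sumList-++ (map f (g x)) _ ⟩
  sumList (map f (g x)) + sumList (map f (concatMap g xs))
    ≡⟨ cong (_+_ (sumList (map f (g x)))) (sumList-concatMap f g xs) ⟩
  sumList (map f (g x)) + sumList (map (λ y → sumList (map f (g y))) xs)  ∎
  where open ≡-Reasoning

sumList-filterᵇ : ∀ (p : S → Bool) (f : S → ℤ) xs →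
  sumList (map f (filterᵇ p xs)) ≡ sumList (map (λ x → if p x then f x else + 0) xs)
sumList-filterᵇ p f []       = refl
sumList-filterᵇ p f (x ∷ xs) with p x
... | true  = cong (_+_ (f x)) (sumList-filterᵇ p f xs)
... | false = trans (sumList-filterᵇ p f xs) (sym (+-identityˡ _))

sumList-tabulate : (f : Fin m → ℤ) → sumList (tabulate f) ≡ sum f
sumList-tabulate {zero}  f = refl
sumList-tabulate {suc m} f = cong (_+_ (f zero)) (sumList-tabulate (f ∘ suc))

sumList-allFin : (f : Fin m → ℤ) → sumList (map f (allFin m)) ≡ sum f
sumList-allFin f = trans (cong sumList (map-tabulate id f)) (sumList-tabulate f)

sumFin≡sum : (f : Fin m → ℤ) → sumFin f ≡ sum f
sumFin≡sum {zero}  f = refl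
sumFin≡sum {suc m} f = cong (_+_ (f zero)) (sumFin≡sum (f ∘ suc))

sum-punchIn : (p : Fin (suc m)) (f : Fin (suc m) → ℤ) → f p ≡ + 0 → sum f ≡ sum (f ∘ punchIn p)
sum-punchIn p f fp≡0 =
  trans (sum-remove f) (trans (cong (_+ sum (f ∘ punchIn p)) fp≡0) (+-identityˡ _))

sum-single : (p : Fin (suc m)) (f : Fin (suc m) → ℤ) → (∀ l → f (punchIn p l) ≡ + 0) → sum f ≡ f p
sum-single {m} p f zeros = begin
  sum f                      ≡⟨ sum-remove f ⟩
  f p + sum (f ∘ punchIn p)  ≡⟨ cong (_+_ (f p)) (sum-cong-≗ {m} zeros) ⟩
  f p + sum {m} (λ _ → + 0)  ≡⟨ cong (_+_ (f p)) (sum-replicate-zero m) ⟩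
  f p + + 0                  ≡⟨ +-identityʳ (f p) ⟩
  f p                        ∎
  where open ≡-Reasoning

sum-const : (x : ℤ) → sum {m} (λ _ → x) ≡ + m * x
sum-const {zero}  x = sym (*-zeroˡ x)
sum-const {suc m} x = trans (cong (_+_ x) (sum-const {m} x)) (distrib x (+ m))
  where
  distrib : ∀ x n → x + n * x ≡ (+ 1 + n) * x
  distrib = solve-∀

prodFin-cong : {f g : Fin k → ℤ} → f ≗ g → prodFin f ≡ prodFin g
prodFin-cong {zero}  f≗g = refl
prodFin-cong {suc k} f≗g = cong₂ _*_ (f≗g zero) (prodFin-cong (f≗g ∘ suc))

prodFin-punchIn : (p : Fin (suc k)) (f : Fin (suc k) → ℤ) → prodFin f ≡ f p * prodFin (f ∘ punchIn p)
prodFin-punchIn zero f = refl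
prodFin-punchIn {suc k} (suc p) f = begin
  f zero * prodFin (f ∘ suc)                            ≡⟨ cong (_*_ (f zero)) (prodFin-punchIn p (f ∘ suc)) ⟩
  f zero * (f (suc p) * prodFin (f ∘ suc ∘ punchIn p))  ≡⟨ swap (f zero) (f (suc p)) _ ⟩
  f (suc p) * (f zero * prodFin (f ∘ suc ∘ punchIn p))  ∎
  where
  open ≡-Reasoning
  swap : ∀ a b c → a * (b * c) ≡ b * (a * c)
  swap = solve-∀

sumFun : ((Fin k → Fin m) → ℤ) → ℤ
sumFun {zero}  G = G (λ ())
sumFun {suc k} G = sum λ j → sumFun λ g → G (j ∷ᶠ g)

sumFun-cong : {G H : (Fin k → Fin m) → ℤ} → G ≗ H → sumFun G ≡ sumFun H
sumFun-cong {zero}  G≗H = G≗H _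
sumFun-cong {suc k} G≗H = sum-cong-≗ λ j → sumFun-cong λ g → G≗H (j ∷ᶠ g)

sumFun-zero : sumFun {k} {m} (λ _ → + 0) ≡ + 0
sumFun-zero {zero}      = refl
sumFun-zero {suc k} {m} = begin
  sum {m} (λ _ → sumFun {k} {m} (λ _ → + 0))  ≡⟨ sum-cong-≗ {m} (λ _ → sumFun-zero {k} {m}) ⟩
  sum {m} (λ _ → + 0)                         ≡⟨ sum-replicate-zero m ⟩
  + 0                                         ∎
  where open ≡-Reasoning

*-distribˡ-sumFun : (a : ℤ) (G : (Fin k → Fin m) → ℤ) → a * sumFun G ≡ sumFun (λ g → a * G g)
*-distribˡ-sumFun {zero}      a G = refl
*-distribˡ-sumFun {suc k} {m} a G = begin
  a * sumFun G
    ≡⟨ *-distribˡ-sum {m} a _ ⟩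
  sum {m} (λ j → a * sumFun (λ g → G (j ∷ᶠ g)))
    ≡⟨ sum-cong-≗ {m} (λ j → *-distribˡ-sumFun a (λ g → G (j ∷ᶠ g))) ⟩
  sum {m} (λ j → sumFun (λ g → a * G (j ∷ᶠ g)))
    ∎
  where open ≡-Reasoning

sumList-allFuns : (G : (Fin k → Fin m) → ℤ) → G Preserves _≗_ ⟶ _≡_ →
  sumList (map G (allFuns k m)) ≡ sumFun G
sumList-allFuns {zero}      G G-cong = trans (+-identityʳ _) (G-cong (λ ()))
sumList-allFuns {suc k} {m} G G-cong =
  trans (sumList-concatMap G _ (allFin m))
  (trans (sumList-allFin {m} _)
  (sum-cong-≗ {m} λ j →
    trans (cong sumList (trans (sym (map-∘ (allFuns k m))) (map-cong (λ _ → G-cong head∷tail) (allFuns k m))))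
          (sumList-allFuns (λ g → G (j ∷ᶠ g)) (λ f≗g → G-cong λ { zero → refl ; (suc i) → f≗g i }))))
  where
  head∷tail : ∀ {h : Fin (suc k) → Fin m} → h ≗ (h zero ∷ᶠ h ∘ suc)
  head∷tail zero    = refl
  head∷tail (suc i) = refl

-- Unlike insertAt, this is built from _∷ᶠ_, so that sumFun-insert holds definitionally, without a
-- congruence hypothesis on G.
insert : Vector S k → Fin (suc k) → S → Vector S (suc k)
insert xs zero    v = v ∷ᶠ xs
insert {k = suc k} xs (suc i) v = head xs ∷ᶠ insert (tail xs) i v

insert-lookup : (xs : Vector S k) (i : Fin (suc k)) (v : S) → insert xs i v i ≡ v
insert-lookup xs zero v = refl
insert-lookup {k = suc k} xs (suc i) v = insert-lookup (tail xs) i v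

insert-punchIn : (xs : Vector S k) (i : Fin (suc k)) (v : S) (j : Fin k) →
  insert xs i v (punchIn i j) ≡ xs j
insert-punchIn xs zero v j = refl
insert-punchIn {k = suc k} xs (suc i) v zero    = refl
insert-punchIn {k = suc k} xs (suc i) v (suc j) = insert-punchIn (tail xs) i v j

sumFun-insert : (i : Fin (suc k)) (G : (Fin (suc k) → Fin m) → ℤ) →
  sumFun G ≡ sum (λ j → sumFun (λ g → G (insert g i j)))
sumFun-insert zero G = refl
sumFun-insert {suc k} {m} (suc i) G =
  trans (sum-cong-≗ {m} λ a → sumFun-insert i (λ g → G (a ∷ᶠ g))) (∑-comm {m} {m} _)

-- Injective maps between finite sets

data PunchInView (i : Fin (suc k)) : Fin (suc k) → Set where
  at    : PunchInView i i
  punch : (j : Fin k) → PunchInView i (punchIn i j)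

punchInView : (i a : Fin (suc k)) → PunchInView i a
punchInView i a with i ≟ a
... | yes refl = at
... | no  i≢a  = subst (PunchInView i) (punchIn-punchOut i≢a) (punch (punchOut i≢a))

injective? : (σ : Fin k → Fin m) → Dec (Injective _≡_ _≡_ σ)
injective? σ = map′ (λ inj {x} {y} → inj x y) (λ inj x y → inj)
                    (all? λ x → all? λ y → σ x ≟ σ y →-dec x ≟ y)

injective-cong : {f g : Fin k → Fin m} → f ≗ g → Injective _≡_ _≡_ f ⇔ Injective _≡_ _≡_ g
injective-cong f≗g =
  mk⇔ (λ inj {a} {b} eq → inj (trans (f≗g a) (trans eq (sym (f≗g b)))))
      (λ inj {a} {b} eq → inj (trans (sym (f≗g a)) (trans eq (f≗g b))))

Avoids : Fin m → (Fin k → Fin m) → Set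
Avoids j g = ∀ l → g l ≢ j

avoids? : (j : Fin m) (g : Fin k → Fin m) → Dec (Avoids j g)
avoids? j g = all? λ l → ¬? (g l ≟ j)

avoids-∷ : (j a : Fin m) (g : Fin k → Fin m) → a ≢ j → Avoids j (a ∷ᶠ g) ⇔ Avoids j g
avoids-∷ j a g a≢j =
  mk⇔ (λ avoids l → avoids (suc l)) λ { avoids zero → a≢j ; avoids (suc l) → avoids l }

injective-insert : (g : Fin k → Fin m) (i : Fin (suc k)) (j : Fin m) →
  Injective _≡_ _≡_ (insert g i j) ⇔ (Avoids j g × Injective _≡_ _≡_ g)
injective-insert g i j = mk⇔ to from
  where
  lookup : insert g i j i ≡ j
  lookup = insert-lookup g i j
  punchIn≡ : ∀ l → insert g i j (punchIn i l) ≡ g l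
  punchIn≡ = insert-punchIn g i j
  to : Injective _≡_ _≡_ (insert g i j) → Avoids j g × Injective _≡_ _≡_ g
  to inj = (λ l gl≡j → punchInᵢ≢i i l (inj (trans (punchIn≡ l) (trans gl≡j (sym lookup)))))
         , (λ {a} {b} ga≡gb →
              punchIn-injective i a b (inj (trans (punchIn≡ a) (trans ga≡gb (sym (punchIn≡ b))))))
  from : Avoids j g × Injective _≡_ _≡_ g → Injective _≡_ _≡_ (insert g i j)
  from (avoids , inj) {a} {b} eq with punchInView i a | punchInView i b
  ... | at      | at       = refl
  ... | at      | punch l  = ⊥-elim (avoids l (trans (sym (punchIn≡ l)) (trans (sym eq) lookup)))
  ... | punch l | at       = ⊥-elim (avoids l (trans (sym (punchIn≡ l)) (trans eq lookup)))
  ... | punch l | punch l′ = cong (punchIn i) (inj (trans (sym (punchIn≡ l)) (trans eq (punchIn≡ l′))))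

injective-punchIn∘ : (j : Fin (suc m)) (h : Fin k → Fin m) →
  Injective _≡_ _≡_ (punchIn j ∘ h) ⇔ Injective _≡_ _≡_ h
injective-punchIn∘ j h = mk⇔ (λ inj {a} {b} eq → inj (cong (punchIn j) eq))
                             (λ inj {a} {b} eq → inj (punchIn-injective j (h a) (h b) eq))

allᵇ-tabulate⁻ : (p : S → Bool) (f : Fin k → S) → T (allᵇ p (tabulate f)) → ∀ i → T (p (f i))
allᵇ-tabulate⁻ {k = suc k} p f all with p (f zero) in eq
... | true  = λ { zero → subst T (sym eq) _ ; (suc i) → allᵇ-tabulate⁻ p (f ∘ suc) all i }
allᵇ-tabulate⁻ {k = suc k} p f () | false

allᵇ-tabulate⁺ : (p : S → Bool) (f : Fin k → S) → (∀ i → T (p (f i))) → T (allᵇ p (tabulate f))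
allᵇ-tabulate⁺ {k = zero}  p f all = _
allᵇ-tabulate⁺ {k = suc k} p f all with p (f zero) | all zero
... | true | _ = allᵇ-tabulate⁺ p (f ∘ suc) (all ∘ suc)

injectivity-test : (σ : Fin k → Fin m) (i j : Fin k) →
  T (⌊ i ≟ j ⌋ ∨ not ⌊ σ i ≟ σ j ⌋) ⇔ (σ i ≡ σ j → i ≡ j)
injectivity-test σ i j with i ≟ j | σ i ≟ σ j
... | yes i≡j | _         = mk⇔ (λ _ _ → i≡j) _
... | no  i≢j | yes σi≡σj = mk⇔ (λ ()) (λ inj → i≢j (inj σi≡σj))
... | no  _   | no  σi≢σj = mk⇔ (λ _ σi≡σj → ⊥-elim (σi≢σj σi≡σj)) _

isInjective-correct : (σ : Fin m → Fin m) → T (isInjective σ) ⇔ Injective _≡_ _≡_ σ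
isInjective-correct σ = mk⇔
  (λ test {i} {j} → Equivalence.to (injectivity-test σ i j)
                      (allᵇ-tabulate⁻ _ id (allᵇ-tabulate⁻ _ id test i) j))
  (λ inj → allᵇ-tabulate⁺ _ id λ i → allᵇ-tabulate⁺ _ id λ j →
             Equivalence.from (injectivity-test σ i j) inj)

-- Laplace expansion of the permanent

permTerm : (Fin k → Fin m → ℤ) → (Fin k → Fin m) → ℤ
permTerm M σ = if does (injective? σ) then prodFin (λ i → M i (σ i)) else + 0

permTerm-cong : (M : Fin k → Fin m → ℤ) → permTerm M Preserves _≗_ ⟶ _≡_
permTerm-cong M {f} {g} f≗g =
  cong₂ (λ b x → if b then x else + 0)
        (does-⇔ (injective-cong f≗g) (injective? f) (injective? g))
        (prodFin-cong λ i → cong (M i) (f≗g i))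

permTerm-insert : (M : Fin (suc k) → Fin m → ℤ) (i : Fin (suc k)) (j : Fin m) (g : Fin k → Fin m) →
  permTerm M (insert g i j) ≡ (if does (avoids? j g) then M i j * permTerm (M ∘ punchIn i) g else + 0)
permTerm-insert {k} M i j g = begin
  permTerm M (insert g i j)
    ≡⟨ cong₂ (λ b x → if b then x else + 0)
             (does-⇔ (injective-insert g i j) (injective? _) (avoids? j g ×-dec injective? g))
             (prodFin-punchIn i (λ p → M p (insert g i j p))) ⟩
  (if avoids∧injective
     then M i (insert g i j i) * prodFin (λ l → M (punchIn i l) (insert g i j (punchIn i l)))
     else + 0)
    ≡⟨ cong₂ (λ x y → if avoids∧injective then M i x * y else + 0)
             (insert-lookup g i j) (prodFin-cong {k} λ l → cong (M (punchIn i l)) (insert-punchIn g i j l)) ⟩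
  (if avoids∧injective then M i j * prodFin (λ l → M (punchIn i l) (g l)) else + 0)
    ≡⟨ if-∧ (does (avoids? j g)) (does (injective? g)) {M i j} {prodFin (λ l → M (punchIn i l) (g l))} ⟩
  (if does (avoids? j g) then M i j * permTerm (M ∘ punchIn i) g else + 0)
    ∎
  where
  open ≡-Reasoning
  avoids∧injective = does (avoids? j g) ∧ does (injective? g)
  if-∧ : ∀ b c {x y : ℤ} → (if b ∧ c then x * y else + 0) ≡ (if b then x * (if c then y else + 0) else + 0)
  if-∧ true  true      = refl
  if-∧ true  false {x} = sym (*-zeroʳ x)
  if-∧ false c         = refl

permTerm-punchIn∘ : (M : Fin k → Fin (suc m) → ℤ) (j : Fin (suc m)) (h : Fin k → Fin m) →
  permTerm M (punchIn j ∘ h) ≡ permTerm (λ a b → M a (punchIn j b)) h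
permTerm-punchIn∘ M j h =
  cong (λ b → if b then prodFin (λ i → M i (punchIn j (h i))) else + 0)
       (does-⇔ (injective-punchIn∘ j h) (injective? _) (injective? h))

sumFun-avoiding : (j : Fin (suc m)) (H : (Fin k → Fin (suc m)) → ℤ) → H Preserves _≗_ ⟶ _≡_ →
  sumFun (λ g → if does (avoids? j g) then H g else + 0) ≡ sumFun (λ h → H (punchIn j ∘ h))
sumFun-avoiding {m = m} {k = zero} j H H-cong = empty _ _
  where
  empty : (e : Fin 0 → Fin (suc m)) (e′ : Fin 0 → Fin m) →
    (if does (avoids? j e) then H e else + 0) ≡ H (punchIn j ∘ e′)
  empty e e′ = trans (cong (λ b → if b then H e else + 0) (dec-true (avoids? j e) λ ())) (H-cong λ ())
sumFun-avoiding {m = m} {k = suc k} j H H-cong = begin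
  sum restricted                                               ≡⟨ sum-punchIn j restricted at-j ⟩
  sum (λ b → restricted (punchIn j b))                         ≡⟨ sum-cong-≗ {m} off-j ⟩
  sum (λ b → sumFun (λ h → H (punchIn j b ∷ᶠ punchIn j ∘ h)))
    ≡⟨ sum-cong-≗ {m} (λ b → sumFun-cong λ h → H-cong (punchIn-∷ b h)) ⟩
  sum (λ b → sumFun (λ h → H (punchIn j ∘ (b ∷ᶠ h))))          ∎
  where
  open ≡-Reasoning
  restricted : Fin (suc m) → ℤ
  restricted a = sumFun λ g → if does (avoids? j (a ∷ᶠ g)) then H (a ∷ᶠ g) else + 0
  at-j : restricted j ≡ + 0
  at-j = trans (sumFun-cong λ g → cong (λ b → if b then H (j ∷ᶠ g) else + 0)
                                       (dec-false (avoids? j (j ∷ᶠ g)) λ avoids → avoids zero refl))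
               (sumFun-zero {k})
  off-j : ∀ b → restricted (punchIn j b) ≡ sumFun (λ h → H (punchIn j b ∷ᶠ punchIn j ∘ h))
  off-j b = trans (sumFun-cong λ g → cong (λ c → if c then H (punchIn j b ∷ᶠ g) else + 0)
                                          (does-⇔ (avoids-∷ j _ g (punchInᵢ≢i j b)) (avoids? j _) (avoids? j g)))
                  (sumFun-avoiding j _ λ f≗g → H-cong λ { zero → refl ; (suc i) → f≗g i })
  punchIn-∷ : (b : Fin m) (h : Fin k → Fin m) → (punchIn j b ∷ᶠ punchIn j ∘ h) ≗ punchIn j ∘ (b ∷ᶠ h)
  punchIn-∷ b h zero    = refl
  punchIn-∷ b h (suc i) = refl

per≡sumFun : (A : Matrix k) → per A ≡ sumFun (permTerm A)
per≡sumFun {k} A = begin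
  per A
    ≡⟨ sumList-filterᵇ isInjective _ (allFuns k k) ⟩
  sumList (map (λ σ → if isInjective σ then prodFin (λ i → A i (σ i)) else + 0) (allFuns k k))
    ≡⟨ cong sumList (map-cong (λ σ → cong (λ b → if b then prodFin (λ i → A i (σ i)) else + 0)
                                         (does-⇔ (isInjective-correct σ) (T? _) (injective? σ)))
                              (allFuns k k)) ⟩
  sumList (map (permTerm A) (allFuns k k))
    ≡⟨ sumList-allFuns (permTerm A) (permTerm-cong A) ⟩
  sumFun (permTerm A)
    ∎
  where open ≡-Reasoning

per-cong : {A B : Matrix k} → (∀ i j → A i j ≡ B i j) → per A ≡ per B
per-cong {k} A≗B =
  cong sumList (map-cong (λ σ → prodFin-cong λ i → A≗B i (σ i)) (filterᵇ isInjective (allFuns k k)))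

minor : Fin (suc k) → Fin (suc k) → Matrix (suc k) → Matrix k
minor i j A a b = A (punchIn i a) (punchIn j b)

per-laplace : (A : Matrix (suc k)) (i : Fin (suc k)) → per A ≡ sum (λ j → A i j * per (minor i j A))
per-laplace {k} A i = begin
  per A                                                 ≡⟨ per≡sumFun A ⟩
  sumFun (permTerm A)                                   ≡⟨ sumFun-insert i (permTerm A) ⟩
  sum (λ j → sumFun (λ g → permTerm A (insert g i j)))  ≡⟨ sum-cong-≗ {suc k} expand ⟩
  sum (λ j → A i j * per (minor i j A))                 ∎
  where
  open ≡-Reasoning
  expand : (j : Fin (suc k)) → sumFun (λ g → permTerm A (insert g i j)) ≡ A i j * per (minor i j A)
  expand j = begin
    sumFun (λ g → permTerm A (insert g i j))
      ≡⟨ sumFun-cong (permTerm-insert A i j) ⟩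
    sumFun (λ g → if does (avoids? j g) then A i j * permTerm (A ∘ punchIn i) g else + 0)
      ≡⟨ sumFun-avoiding j _ (λ f≗g → cong (A i j *_) (permTerm-cong (A ∘ punchIn i) f≗g)) ⟩
    sumFun (λ h → A i j * permTerm (A ∘ punchIn i) (punchIn j ∘ h))
      ≡⟨ sumFun-cong (λ h → cong (A i j *_) (permTerm-punchIn∘ (A ∘ punchIn i) j h)) ⟩
    sumFun (λ h → A i j * permTerm (minor i j A) h)
      ≡⟨ *-distribˡ-sumFun (A i j) (permTerm (minor i j A)) ⟨
    A i j * sumFun (permTerm (minor i j A))
      ≡⟨ cong (A i j *_) (per≡sumFun (minor i j A)) ⟨
    A i j * per (minor i j A)
      ∎

per-add-diagonal-entry : (A B : Matrix (suc k)) (p : Fin (suc k)) (c : ℤ) →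
  (∀ a j → A (punchIn p a) j ≡ B (punchIn p a) j) →
  (∀ j → A p j ≡ B p j + (if does (p ≟ j) then c else + 0)) →
  per A ≡ per B + c * per (minor p p B)
per-add-diagonal-entry {k} A B p c other-rows row-p = begin
  per A
    ≡⟨ per-laplace A p ⟩
  sum (λ j → A p j * per (minor p j A))
    ≡⟨ sum-cong-≗ {suc k} (λ j → trans (cong₂ _*_ (row-p j) (per-cong λ a b → other-rows a (punchIn j b)))
                                       (*-distribʳ-+ (minorB j) (B p j) (δ j))) ⟩
  sum (λ j → B p j * minorB j + δ j * minorB j)
    ≡⟨ ∑-distrib-+ (λ j → B p j * minorB j) (λ j → δ j * minorB j) ⟩
  sum (λ j → B p j * minorB j) + sum (λ j → δ j * minorB j)
    ≡⟨ cong₂ _+_ (per-laplace B p) (sym (sum-single p (λ j → δ j * minorB j) off-diagonal)) ⟨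
  per B + δ p * minorB p
    ≡⟨ cong (λ b → per B + (if b then c else + 0) * minorB p) (dec-true (p ≟ p) refl) ⟩
  per B + c * per (minor p p B)
    ∎
  where
  open ≡-Reasoning
  minorB δ : Fin (suc k) → ℤ
  minorB j = per (minor p j B)
  δ j = if does (p ≟ j) then c else + 0
  off-diagonal : ∀ l → δ (punchIn p l) * minorB (punchIn p l) ≡ + 0
  off-diagonal l = trans (cong (λ b → (if b then c else + 0) * minorB (punchIn p l))
                               (dec-false (p ≟ punchIn p l) (punchInᵢ≢i p l ∘ sym)))
                         (*-zeroˡ (minorB (punchIn p l)))

-- The permanent of c I + o J

n<ᵇ1+n : ∀ n → (n <ᵇ suc n) ≡ true
n<ᵇ1+n zero    = refl
n<ᵇ1+n (suc n) = n<ᵇ1+n n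

n<ᵇn : ∀ n → (n <ᵇ n) ≡ false
n<ᵇn zero    = refl
n<ᵇn (suc n) = n<ᵇn n

toℕ-punchIn-<ᵇ : (p : Fin (suc k)) (a : Fin k) → (toℕ (punchIn p a) <ᵇ toℕ p) ≡ (toℕ a <ᵇ toℕ p)
toℕ-punchIn-<ᵇ zero    a       = refl
toℕ-punchIn-<ᵇ (suc p) zero    = refl
toℕ-punchIn-<ᵇ (suc p) (suc a) = toℕ-punchIn-<ᵇ p a

toℕ-punchIn-<ᵇ-suc : (p : Fin (suc k)) (a : Fin k) →
  (toℕ (punchIn p a) <ᵇ suc (toℕ p)) ≡ (toℕ a <ᵇ toℕ p)
toℕ-punchIn-<ᵇ-suc zero    a       = refl
toℕ-punchIn-<ᵇ-suc (suc p) zero    = refl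
toℕ-punchIn-<ᵇ-suc (suc p) (suc a) = toℕ-punchIn-<ᵇ-suc p a

module ConstantPlusDiagonal (o c : ℤ) where

  prefixDiag : ℕ → Matrix k
  prefixDiag r i j = o + (if (toℕ i <ᵇ r) ∧ does (i ≟ j) then c else + 0)

  constPer : ℕ → ℤ
  constPer zero    = + 1
  constPer (suc k) = + suc k * (o * constPer k)

  per-const : per {k} (λ _ _ → o) ≡ constPer k
  per-const {zero}  = refl
  per-const {suc k} = begin
    per {suc k} (λ _ _ → o)
      ≡⟨ per-laplace {k} (λ _ _ → o) zero ⟩
    sum {suc k} (λ _ → o * per {k} (λ _ _ → o))
      ≡⟨ sum-cong-≗ {suc k} (λ _ → cong (o *_) (per-const {k})) ⟩
    sum {suc k} (λ _ → o * constPer k)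
      ≡⟨ sum-const {suc k} (o * constPer k) ⟩
    constPer (suc k)
      ∎
    where open ≡-Reasoning

  per-prefixDiag-step : ∀ r → r ℕ.< suc k →
    per {suc k} (prefixDiag (suc r)) ≡ per {suc k} (prefixDiag r) + c * per {k} (prefixDiag r)
  per-prefixDiag-step {k} r r<1+k with fromℕ< r<1+k | toℕ-fromℕ< r<1+k
  ... | p | refl =
    trans (per-add-diagonal-entry (prefixDiag (suc (toℕ p))) (prefixDiag (toℕ p)) p c other-rows row-p)
          (cong (λ x → per {suc k} (prefixDiag (toℕ p)) + c * x) (per-cong diagonal-minor))
    where
    other-rows : ∀ a j → prefixDiag (suc (toℕ p)) (punchIn p a) j ≡ prefixDiag (toℕ p) (punchIn p a) j
    other-rows a j = cong (λ b → o + (if b ∧ does (punchIn p a ≟ j) then c else + 0))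
                          (trans (toℕ-punchIn-<ᵇ-suc p a) (sym (toℕ-punchIn-<ᵇ p a)))
    row-p : ∀ j → prefixDiag (suc (toℕ p)) p j ≡ prefixDiag (toℕ p) p j + (if does (p ≟ j) then c else + 0)
    row-p j rewrite n<ᵇ1+n (toℕ p) | n<ᵇn (toℕ p) = cong (_+ _) (sym (+-identityʳ o))
    diagonal-minor : ∀ a b → minor p p (prefixDiag (toℕ p)) a b ≡ prefixDiag (toℕ p) a b
    diagonal-minor a b =
      cong₂ (λ b₁ b₂ → o + (if b₁ ∧ b₂ then c else + 0))
            (toℕ-punchIn-<ᵇ p a)
            (does-⇔ (mk⇔ (punchIn-injective p a b) (cong (punchIn p))) (punchIn p a ≟ punchIn p b) (a ≟ b))

  -- Q k r = ∑_{j ≤ r} C(r, j) (k − j)! c^j o^(k−j); only r ≤ k is meaningful, and the clause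
  -- Q zero (suc r) is junk.
  Q : ℕ → ℕ → ℤ
  Q k       zero    = constPer k
  Q zero    (suc r) = + 1
  Q (suc k) (suc r) = Q (suc k) r + c * Q k r

  per-prefixDiag : ∀ r → r ℕ.≤ k → per {k} (prefixDiag r) ≡ Q k r
  per-prefixDiag {k} zero _ = trans (per-cong {k} λ _ _ → +-identityʳ o) (per-const {k})
  per-prefixDiag {suc k} (suc r) (s≤s r≤k) =
    trans (per-prefixDiag-step r (s≤s r≤k))
          (cong₂ (λ x y → x + c * y) (per-prefixDiag {suc k} r (ℕ.m≤n⇒m≤1+n r≤k))
                                     (per-prefixDiag {k} r r≤k))

  H : ℕ → ℤ
  H zero    = + 1
  H (suc k) = c ^ suc k + + suc k * (o * H k)

  Q-size-step : ∀ k r → r ℕ.≤ k →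
    Q (suc (suc k)) (suc r) ≡ o * (+ suc (suc k) * Q (suc k) (suc r) - + suc r * (c * Q k r))
  Q-size-step k zero _ = identity o c (+ k) (constPer k)
    where
    identity : ∀ o c K q → (+ 1 + (+ 1 + K)) * (o * ((+ 1 + K) * (o * q))) + c * ((+ 1 + K) * (o * q))
                           ≡ o * ((+ 1 + (+ 1 + K)) * ((+ 1 + K) * (o * q) + c * q) - (+ 1 + + 0) * (c * q))
    identity = solve-∀
  Q-size-step (suc k) (suc r) (s≤s r≤k)
    rewrite Q-size-step (suc k) r (ℕ.m≤n⇒m≤1+n r≤k) | Q-size-step k r r≤k =
    identity o c (+ k) (+ r) (Q (suc k) r) (Q k r)
    where
    identity : ∀ o c K R B C → let A = o * ((+ 1 + (+ 1 + K)) * (B + c * C) - (+ 1 + R) * (c * C)) in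
      o * ((+ 1 + (+ 1 + (+ 1 + K))) * A - (+ 1 + R) * (c * B)) + c * A
        ≡ o * ((+ 1 + (+ 1 + (+ 1 + K))) * (A + c * (B + c * C)) - (+ 1 + (+ 1 + R)) * (c * (B + c * C)))
    identity = solve-∀

  -- On the diagonal, Q-size-step says H (k + 2) − (k + 2) o H (k + 1) = c (H (k + 1) − (k + 1) o H k).
  Q-diagonal : ∀ k → Q k k ≡ H k
  Q-diagonal zero          = refl
  Q-diagonal (suc zero)    = identity o c
    where
    identity : ∀ o c → + 1 * (o * + 1) + c * + 1 ≡ c * + 1 + + 1 * (o * + 1)
    identity = solve-∀
  Q-diagonal (suc (suc k)) =
    trans (cong (_+ c * Q (suc k) (suc k)) (Q-size-step k k ℕ.≤-refl))
    (trans (cong₂ (λ a b → o * (+ suc (suc k) * a - + suc k * (c * b)) + c * a) (Q-diagonal (suc k)) (Q-diagonal k))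
           (identity o c (+ k) (c ^ suc k) (H k)))
    where
    identity : ∀ o c K P h → let H₁ = P + (+ 1 + K) * (o * h) in
      o * ((+ 1 + (+ 1 + K)) * H₁ - (+ 1 + K) * (c * h)) + c * H₁ ≡ c * P + (+ 1 + (+ 1 + K)) * (o * H₁)
    identity = solve-∀

  per-const-plus-scalar : per {k} (λ i j → o + (if does (i ≟ j) then c else + 0)) ≡ H k
  per-const-plus-scalar {k} =
    trans (per-cong {k} λ i j → cong (λ b → o + (if b ∧ does (i ≟ j) then c else + 0))
                                     (sym (Equivalence.to T-≡ (ℕ.<⇒<ᵇ (toℕ<n i)))))
          (trans (per-prefixDiag k ℕ.≤-refl) (Q-diagonal k))

open ConstantPlusDiagonal using (H)

-- Integer estimates

0≤+ : ∀ n → + 0 ≤ + n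
0≤+ n = +≤+ z≤n

+-nonNeg : ∀ {a b} → + 0 ≤ a → + 0 ≤ b → + 0 ≤ a + b
+-nonNeg = +-mono-≤

*-nonNeg : ∀ {a b} → + 0 ≤ a → + 0 ≤ b → + 0 ≤ a * b
*-nonNeg {+ m} {+ n} _ _ = subst (+ 0 ≤_) (pos-* m n) (0≤+ (m ℕ.* n))

*-pos : ∀ {a b} → + 0 < a → + 0 < b → + 0 < a * b
*-pos {+ suc m} {+ suc n} _        _        = +<+ (s≤s z≤n)
*-pos {+ zero}            (+<+ ()) _
*-pos {+ suc m} {+ zero}  _        (+<+ ())

^-nonNeg : ∀ {a} k → + 0 ≤ a → + 0 ≤ a ^ k
^-nonNeg zero    _   = 0≤+ 1
^-nonNeg (suc k) 0≤a = *-nonNeg 0≤a (^-nonNeg k 0≤a)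

^-distribʳ-* : ∀ a b k → (a * b) ^ k ≡ a ^ k * b ^ k
^-distribʳ-* a b zero    = refl
^-distribʳ-* a b (suc k) = trans (cong (a * b *_) (^-distribʳ-* a b k)) (interchange a b (a ^ k) (b ^ k))
  where
  interchange : ∀ a b p q → a * b * (p * q) ≡ a * p * (b * q)
  interchange = solve-∀

-- All inequalities below go through this: e is a sum of products of factors already known to be
-- non-negative, and the identity p (b − a) ≡ e is checked by the ring solver.
≤-certified : ∀ {a b e} p → + 0 < p → p * (b - a) ≡ e → + 0 ≤ e → a ≤ b
≤-certified {a} {b} p 0<p p[b-a]≡e 0≤e =
  0≤i-j⇒j≤i (*-cancelˡ-≤-pos (+ 0) (b - a) p {{positive 0<p}}
              (subst₂ _≤_ (sym (*-zeroʳ p)) (sym p[b-a]≡e) 0≤e))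

-- The two bounds feed each other in the induction.
alternating-bounds : ∀ xn k → k ℕ.< xn → let x = + xn ; F = H -[1+ 0 ] x in
  (+ 2 * x - + 1) * x ^ k ≤ + 2 * (x + + k) * F k  ×  (x + + k) * F k ≤ x ^ suc k
alternating-bounds xn zero _ = ≤-certified (+ 1) (+<+ (s≤s z≤n)) (base₁ (+ xn)) (0≤+ 1)
                             , ≤-certified (+ 1) (+<+ (s≤s z≤n)) (base₂ (+ xn)) (0≤+ 0)
  where
  base₁ : ∀ x → + 1 * (+ 2 * (x + + 0) * + 1 - (+ 2 * x - + 1) * + 1) ≡ + 1
  base₁ = solve-∀
  base₂ : ∀ x → + 1 * (x * + 1 - (x + + 0) * + 1) ≡ + 0
  base₂ = solve-∀
alternating-bounds xn (suc k) 1+k<xn = lower , upper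
  where
  x = + xn
  K = + k
  F = H -[1+ 0 ] x
  IH = alternating-bounds xn k (ℕ.<-trans (ℕ.n<1+n k) 1+k<xn)
  0<x+k : + 0 < x + K
  0<x+k = +<+ (ℕ.≤-trans (s≤s z≤n) (ℕ.≤-trans (ℕ.<⇒≤ 1+k<xn) (ℕ.m≤m+n xn k)))
  lower-identity : ∀ x K F P →
    (x + K) * (+ 2 * (x + (+ 1 + K)) * (P + (+ 1 + K) * (-[1+ 0 ] * F)) - (+ 2 * x - + 1) * P)
      ≡ P * (x - (+ 2 + K)) + + 2 * (+ 1 + K) * (x + (+ 1 + K)) * (P - (x + K) * F)
  lower-identity = solve-∀
  lower : (+ 2 * x - + 1) * x ^ suc k ≤ + 2 * (x + + suc k) * F (suc k)
  lower = ≤-certified (x + K) 0<x+k (lower-identity x K (F k) (x ^ suc k))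
    (+-nonNeg (*-nonNeg (^-nonNeg (suc k) (0≤+ xn)) (i≤j⇒0≤j-i (+≤+ 1+k<xn)))
              (*-nonNeg (*-nonNeg (*-nonNeg (0≤+ 2) (0≤+ (suc k))) (0≤+ (xn ℕ.+ suc k)))
                        (i≤j⇒0≤j-i (proj₂ IH))))
  upper-identity : ∀ x K F Pk →
    + 2 * (x + K) * (x * (x * Pk) - (x + (+ 1 + K)) * (x * Pk + (+ 1 + K) * (-[1+ 0 ] * F)))
      ≡ (+ 1 + K) * ((x + (+ 1 + K)) * (+ 2 * (x + K) * F - (+ 2 * x - + 1) * Pk) + Pk * (x - (+ 1 + K)))
  upper-identity = solve-∀
  upper : (x + + suc k) * F (suc k) ≤ x ^ suc (suc k)
  upper = ≤-certified (+ 2 * (x + K)) (*-pos {+ 2} (+<+ (s≤s z≤n)) 0<x+k) (upper-identity x K (F k) (x ^ k))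
    (*-nonNeg (0≤+ (suc k)) (+-nonNeg (*-nonNeg (0≤+ (xn ℕ.+ suc k)) (i≤j⇒0≤j-i (proj₁ IH)))
                                      (*-nonNeg (^-nonNeg k (0≤+ xn)) (i≤j⇒0≤j-i (+≤+ (ℕ.<⇒≤ 1+k<xn))))))

growing-bounds : ∀ y → + 0 ≤ y → ∀ k → let G = H (+ 1) y in
  + 0 ≤ G k  ×  (y - + k) * G k ≤ y ^ suc k
growing-bounds y 0≤y zero = 0≤+ 1 , ≤-certified (+ 1) (+<+ (s≤s z≤n)) (base y) (0≤+ 0)
  where
  base : ∀ y → + 1 * (y * + 1 - (y - + 0) * + 1) ≡ + 0
  base = solve-∀
growing-bounds y 0≤y (suc k) = nonNeg , upper
  where
  G = H (+ 1) y
  IH = growing-bounds y 0≤y k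
  nonNeg : + 0 ≤ G (suc k)
  nonNeg = +-nonNeg (^-nonNeg (suc k) 0≤y) (*-nonNeg (0≤+ (suc k)) (*-nonNeg (0≤+ 1) (proj₁ IH)))
  identity : ∀ y K G P → + 1 * (y * P - (y - (+ 1 + K)) * (P + (+ 1 + K) * (+ 1 * G)))
                           ≡ (+ 1 + K) * (P - (y - K) * G) + (+ 1 + K) * G
  identity = solve-∀
  upper : (y - + suc k) * G (suc k) ≤ y ^ suc (suc k)
  upper = ≤-certified (+ 1) (+<+ (s≤s z≤n)) (identity y (+ k) (G k) (y ^ suc k))
            (+-nonNeg (*-nonNeg (0≤+ (suc k)) (i≤j⇒0≤j-i (proj₂ IH))) (*-nonNeg (0≤+ (suc k)) (proj₁ IH)))

0≤n[n-1] : ∀ n → + 0 ≤ + n * (+ n - + 1)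
0≤n[n-1] zero    = 0≤+ 0
0≤n[n-1] (suc n) = subst (+ 0 ≤_) (sym (identity (+ n))) (*-nonNeg (0≤+ (suc n)) (0≤+ n))
  where
  identity : ∀ N → (+ 1 + N) * ((+ 1 + N) - + 1) ≡ (+ 1 + N) * N
  identity = solve-∀

-- The first three terms of the binomial expansion of (z + 2) ^ k, multiplied through by z ^ 2.
binomial-bound : ∀ z k → let Z = + z ; K = + k in
  Z ^ k * (Z * Z + + 2 * K * Z + + 2 * K * (K - + 1)) ≤ Z * Z * (+ (2 ℕ.+ z)) ^ k
binomial-bound z zero = ≤-certified (+ 1) (+<+ (s≤s z≤n)) (base (+ z)) (0≤+ 0)
  where
  base : ∀ Z → + 1 * (Z * Z * + 1 - + 1 * (Z * Z + + 2 * + 0 * Z + + 2 * + 0 * (+ 0 - + 1))) ≡ + 0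
  base = solve-∀
binomial-bound z (suc k) = ≤-certified (+ 1) (+<+ (s≤s z≤n))
  (identity (+ z) (+ k) ((+ 2 + + z) ^ k) ((+ z) ^ k))
  (+-nonNeg (*-nonNeg (0≤+ (2 ℕ.+ z)) (i≤j⇒0≤j-i (binomial-bound z k)))
            (*-nonNeg (^-nonNeg k (0≤+ z)) (*-nonNeg (0≤+ 4) (0≤n[n-1] k))))
  where
  identity : ∀ Z K Q Zk →
    + 1 * (Z * Z * ((+ 2 + Z) * Q) - Z * Zk * (Z * Z + + 2 * (+ 1 + K) * Z + + 2 * (+ 1 + K) * ((+ 1 + K) - + 1)))
      ≡ (+ 2 + Z) * (Z * Z * Q - Zk * (Z * Z + + 2 * K * Z + + 2 * K * (K - + 1))) + Zk * (+ 4 * (K * (K - + 1)))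
  identity = solve-∀

-- With D = k − 2 ≥ 0, the certificate rests on (k² + k − 1)(5k² − 2k) − 4k⁴ = k (D³ + 9D² + 17D + 8).
numeric-bound : ∀ k → let Z = + k ; X = + 2 + Z in + 2 ≤ Z →
  Z ^ k * (Z * Z + + 2 * Z * Z + + 2 * Z * (Z - + 1)) ≤ Z * Z * X ^ k →
  + 4 * (Z ^ suc (suc k) * X ^ suc (suc k)) ≤ (Z * X - (+ 1 + Z)) * (X ^ suc k * X ^ suc k)
numeric-bound k 2≤Z binomial =
  ≤-certified (Z * Z) (*-pos 0<Z 0<Z) (identity Z (X ^ k) (Z ^ k))
    (*-nonNeg (^-nonNeg (2 ℕ.+ k) (0≤+ (2 ℕ.+ k)))
      (+-nonNeg (*-nonNeg (+-nonNeg (+-nonNeg (*-nonNeg 0≤D 0≤D) (*-nonNeg (0≤+ 5) 0≤D)) (0≤+ 5))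
                          (i≤j⇒0≤j-i binomial))
                (*-nonNeg (^-nonNeg k (0≤+ k))
                          (*-nonNeg (0≤+ k) (+-nonNeg (+-nonNeg (+-nonNeg (*-nonNeg (*-nonNeg 0≤D 0≤D) 0≤D)
                                                                          (*-nonNeg (*-nonNeg (0≤+ 9) 0≤D) 0≤D))
                                                                (*-nonNeg (0≤+ 17) 0≤D))
                                                      (0≤+ 8))))))
  where
  Z = + k
  X = + 2 + Z
  0<Z : + 0 < Z
  0<Z = <-≤-trans (+<+ (s≤s z≤n)) 2≤Z
  0≤D : + 0 ≤ Z - + 2
  0≤D = i≤j⇒0≤j-i 2≤Z
  identity : ∀ Z P Zk → let X = + 2 + Z ; D = Z - + 2 in
    Z * Z * ((Z * X - (+ 1 + Z)) * (X * P * (X * P)) - + 4 * (Z * (Z * Zk) * (X * (X * P))))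
      ≡ X * (X * P) * ((D * D + + 5 * D + + 5) * (Z * Z * P - Zk * (Z * Z + + 2 * Z * Z + + 2 * Z * (Z - + 1)))
                       + Zk * (Z * (D * D * D + + 9 * D * D + + 17 * D + + 8)))
  identity = solve-∀

-- With y = Z X, m = k + 1 and d = y − m,
--   4 d (F² − G) = d (4F² − X^(2m)) + (d X^(2m) − 4 y^(m+1)) + 4 (y^(m+1) − d G),
-- where 2F ≥ X^m makes the first part non-negative.  X and M are abstract, matched with refl only
-- here, so that the concrete instance in perB∘B≤perB² is accepted syntactically: unfolding the
-- integer arithmetic of that instance is prohibitively expensive.
squares-core : ∀ k {X M} (F G : ℤ) → let Z = + k in
  + 2 ≤ Z → X ≡ + 2 + Z → M ≡ + 1 + Z →
  (+ 2 * X - + 1) * X ^ suc k ≤ + 2 * (X + M) * F →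
  (Z * X - M) * G ≤ Z ^ suc (suc k) * X ^ suc (suc k) →
  Z ^ k * (Z * Z + + 2 * Z * Z + + 2 * Z * (Z - + 1)) ≤ Z * Z * X ^ k →
  G ≤ F * F
squares-core k F G 2≤Z refl refl alternating growing binomial =
  ≤-certified (+ 4 * d) (*-pos {+ 4} (+<+ (s≤s z≤n)) 0<d)
    (identity d F G (X ^ suc k) (Z ^ suc (suc k) * X ^ suc (suc k)))
    (+-nonNeg (+-nonNeg (*-nonNeg (<⇒≤ 0<d) (*-nonNeg (i≤j⇒0≤j-i X^m≤2F) (+-nonNeg 0≤2F 0≤X^m)))
                        (i≤j⇒0≤j-i (numeric-bound k 2≤Z binomial)))
              (*-nonNeg (0≤+ 4) (i≤j⇒0≤j-i growing)))
  where
  Z = + k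
  X = + 2 + Z
  d = Z * X - (+ 1 + Z)
  d≡1+ : ∀ Z → let D = Z - + 2 in Z * (+ 2 + Z) - (+ 1 + Z) ≡ + 1 + (D * D + + 5 * D + + 4)
  d≡1+ = solve-∀
  0≤D : + 0 ≤ Z - + 2
  0≤D = i≤j⇒0≤j-i 2≤Z
  0<1+ : ∀ {a} → + 0 ≤ a → + 0 < + 1 + a
  0<1+ (+≤+ _) = +<+ (s≤s z≤n)
  0<d : + 0 < d
  0<d = subst (+ 0 <_) (sym (d≡1+ Z))
              (0<1+ (+-nonNeg (+-nonNeg (*-nonNeg 0≤D 0≤D) (*-nonNeg (0≤+ 5) 0≤D)) (0≤+ 4)))
  halving : ∀ Z F Xm → (+ 2 * (+ 2 + Z) - + 1) * (+ 2 * F - Xm)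
                         ≡ + 2 * ((+ 2 + Z) + (+ 1 + Z)) * F - (+ 2 * (+ 2 + Z) - + 1) * Xm
  halving = solve-∀
  X^m≤2F : X ^ suc k ≤ + 2 * F
  X^m≤2F = ≤-certified (+ 2 * X - + 1) (+<+ (s≤s z≤n)) (halving Z F (X ^ suc k)) (i≤j⇒0≤j-i alternating)
  0≤X^m : + 0 ≤ X ^ suc k
  0≤X^m = ^-nonNeg (suc k) (0≤+ (2 ℕ.+ k))
  0≤2F : + 0 ≤ + 2 * F
  0≤2F = ≤-trans 0≤X^m X^m≤2F
  identity : ∀ D F G Xm Y → + 4 * D * (F * F - G)
    ≡ D * ((+ 2 * F - Xm) * (+ 2 * F + Xm)) + (D * (Xm * Xm) - + 4 * Y) + + 4 * (Y - D * G)
  identity = solve-∀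

-- The complete graph

perB : ℕ → ℤ
perB n = H -[1+ 0 ] (+ (2 ℕ.+ n)) (suc n)

perB∘B : ℕ → ℤ
perB∘B n = H (+ 1) (+ n * + (2 ℕ.+ n)) (suc n)

perB∘B≤perB² : ∀ n → perB∘B n ≤ perB n * perB n
perB∘B≤perB² zero            = +≤+ (s≤s z≤n)
perB∘B≤perB² (suc zero)      = +≤+ (ℕ.≤ᵇ⇒≤ 17 25 _)
perB∘B≤perB² n@(suc (suc _)) =
  squares-core n (perB n) (perB∘B n) (+≤+ (s≤s (s≤s z≤n))) refl refl
    (proj₁ (alternating-bounds (2 ℕ.+ n) (suc n) (ℕ.n<1+n (suc n))))
    (≤-trans (proj₂ (growing-bounds (+ n * + (2 ℕ.+ n)) (*-nonNeg (0≤+ n) (0≤+ (2 ℕ.+ n))) (suc n)))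
             (≤-reflexive (^-distribʳ-* (+ n) (+ (2 ℕ.+ n)) (suc (suc n)))))
    (binomial-bound n n)

degree-complete : (i : Fin (suc k)) → degree (completeGraph (suc k)) i ≡ + k
degree-complete {k} i = begin
  degree (completeGraph (suc k)) i
    ≡⟨ sumFin≡sum adj ⟩
  sum adj
    ≡⟨ sum-punchIn i adj (adj-at (dec-true (i ≟ i) refl)) ⟩
  sum (adj ∘ punchIn i)
    ≡⟨ sum-cong-≗ {k} (λ l → adj-at (dec-false (i ≟ punchIn i l) (punchInᵢ≢i i l ∘ sym))) ⟩
  sum {k} (λ _ → + 1)
    ≡⟨ sum-const {k} (+ 1) ⟩
  + k * + 1
    ≡⟨ *-identityʳ (+ k) ⟩
  + k
    ∎
  where
  open ≡-Reasoning
  adj = adjacency (completeGraph (suc k)) i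
  adj-at : ∀ {j b} → does (i ≟ j) ≡ b → adj j ≡ (if not b then + 1 else + 0)
  adj-at {j} eq = cong (λ b → if not b then + 1 else + 0) (trans (isYes≗does (i ≟ j)) eq)

laplacian-complete-minor : ∀ n (v : Fin (suc (suc n))) a b →
  deleteRowCol v (laplacian (completeGraph (suc (suc n)))) a b
    ≡ -[1+ 0 ] + (if does (a ≟ b) then + (2 ℕ.+ n) else + 0)
laplacian-complete-minor n v a b with punchIn v a ≟ punchIn v b | a ≟ b
... | yes _     | yes _   = trans (+-identityʳ _) (degree-complete (punchIn v a))
... | no _      | no _    = refl
... | yes va≡vb | no a≢b  = ⊥-elim (a≢b (punchIn-injective v a b va≡vb))
... | no va≢vb  | yes a≡b = ⊥-elim (va≢vb (cong (punchIn v) a≡b))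

square-entry : ∀ n (b : Bool) → let e = -[1+ 0 ] + (if b then + (2 ℕ.+ n) else + 0) in
  e * e ≡ + 1 + (if b then + n * + (2 ℕ.+ n) else + 0)
square-entry n true  = identity (+ n)
  where
  identity : ∀ N → (-[1+ 0 ] + (+ 2 + N)) * (-[1+ 0 ] + (+ 2 + N)) ≡ + 1 + N * (+ 2 + N)
  identity = solve-∀
square-entry n false = refl

lemma5p3 : (n : ℕ) → (v : Fin (suc (suc n))) →
    let B = deleteRowCol v (laplacian (completeGraph (suc (suc n)))) in
    per (B ∘ₕ B) ≤ per B * per B
lemma5p3 n v = subst₂ (λ a b → a ≤ b * b) (sym per-B∘B) (sym per-B) (perB∘B≤perB² n)
  where
  B = deleteRowCol v (laplacian (completeGraph (suc (suc n))))
  per-B : per B ≡ perB n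
  per-B = trans (per-cong (laplacian-complete-minor n v))
                (ConstantPlusDiagonal.per-const-plus-scalar -[1+ 0 ] (+ (2 ℕ.+ n)) {suc n})
  per-B∘B : per (B ∘ₕ B) ≡ perB∘B n
  per-B∘B = trans (per-cong λ a b → trans (cong (λ e → e * e) (laplacian-complete-minor n v a b))
                                          (square-entry n (does (a ≟ b))))
                  (ConstantPlusDiagonal.per-const-plus-scalar (+ 1) (+ n * + (2 ℕ.+ n)) {suc n})
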